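{- Let $G$ be an AR-graph and $v$ a vertex of $G$ of degree $2$. Let $G'$ be obtained from $G$ by identifying an end vertex of a new path with at least $2$ edges (otherwise vertex-disjoint from $G$) with $v$. Then $G'$ is an AR-graph.
   Context: All graphs are finite, simple and undirected; $\mathbb{N}=\{1,2,3,\dots\}$. Let $f:E(G)\to\mathbb{N}$ be an injective edge labeling of a graph $G$. A vertex $v$ is an AR-vertex (under $f$) if, whenever $x_1,\dots,x_k$ are the labels of the $k$ edges incident on $v$, the $2^k$ sums $\sum_{i\in S}x_i$ over all subsets $S\subseteq\{1,\dots,k\}$ are pairwise distinct. An injective labeling $f$ is an AR-labeling if every vertex is an AR-vertex under $f$. A graph $G$ with $m$ edges is an AR-graph if it has an AR-labeling $f:E(G)\to\{1,2,\dots,m\}$. -}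

module Defs where

open import Data.Nat using (ℕ; zero; suc; _+_; _≤_)
open import Data.Fin using (Fin; zero; suc; _↑ˡ_; _↑ʳ_; inject₁; splitAt; _≟_)
open import Data.Fin.Subset using (Subset; _⊆_; ∣_∣)
open import Data.Vec using (tabulate; lookup; sum)
open import Data.Bool using (Bool; if_then_else_; _∨_)
open import Data.Product using (_×_; _,_; proj₁; proj₂; Σ)
open import Data.Sum using (_⊎_; inj₁; inj₂)
open import Relation.Nullary using (¬_)
open import Relation.Nullary.Decidable using (⌊_⌋)
open import Relation.Binary.PropositionalEquality using (_≡_)
open import Function.Definitions using (Injective)

record Graph : Set where
  field
    n    : ℕ
    m    : ℕ
    ends : Fin m → Fin n × Fin n
open Graph public

SameEnds : {n : ℕ} → Fin n × Fin n → Fin n × Fin n → Set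
SameEnds (a , b) (c , d) = (a ≡ c × b ≡ d) ⊎ (a ≡ d × b ≡ c)

IsSimple : Graph → Set
IsSimple G =
  (∀ e → ¬ (proj₁ (ends G e) ≡ proj₂ (ends G e))) ×
  (∀ e e' → SameEnds (ends G e) (ends G e') → e ≡ e')

incident : (G : Graph) → Fin (n G) → Subset (m G)
incident G v = tabulate λ e → ⌊ proj₁ (ends G e) ≟ v ⌋ ∨ ⌊ proj₂ (ends G e) ≟ v ⌋

degree : (G : Graph) → Fin (n G) → ℕ
degree G v = ∣ incident G v ∣

subsetSum : {m : ℕ} → (Fin m → ℕ) → Subset m → ℕ
subsetSum f S = sum (tabulate λ e → if lookup S e then f e else 0)

IsARVertex : (G : Graph) → (Fin (m G) → ℕ) → Fin (n G) → Set
IsARVertex G f v =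
  ∀ (S T : Subset (m G)) → S ⊆ incident G v → T ⊆ incident G v →
  subsetSum f S ≡ subsetSum f T → S ≡ T

IsARLabeling : (G : Graph) → (Fin (m G) → ℕ) → Set
IsARLabeling G f = Injective _≡_ _≡_ f × (∀ v → IsARVertex G f v)

IsARGraph : Graph → Set
IsARGraph G = Σ (Fin (m G) → ℕ) λ f →
  (∀ e → (1 ≤ f e) × (f e ≤ m G)) × IsARLabeling G f

-- New vertices: n ↑ʳ j (j : Fin k), path vertices
-- p₀ = v, p_{j+1} = n ↑ʳ j; new edge i joins p_i and p_{i+1}.
pathVertex : (G : Graph) → Fin (n G) → (k : ℕ) → Fin (suc k) → Fin (n G + k)
pathVertex G v k zero    = v ↑ˡ k
pathVertex G v k (suc j) = n G ↑ʳ j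

attachPath : (G : Graph) → Fin (n G) → ℕ → Graph
attachPath G v k = record
  { n    = n G + k
  ; m    = m G + k
  ; ends = λ e → edgeEnds (splitAt (m G) e)
  }
  where
    edgeEnds : Fin (m G) ⊎ Fin k → Fin (n G + k) × Fin (n G + k)
    edgeEnds (inj₁ e) = proj₁ (ends G e) ↑ˡ k , proj₂ (ends G e) ↑ˡ k
    edgeEnds (inj₂ i) = pathVertex G v k (inject₁ i) , pathVertex G v k (suc i)

-- Keep the AR-labelling f of G on the old edges and give the k new path edges the labels
-- m + 1, …, m + k, ordered so that the edge at v does not get the label f e₁ + f e₂, where e₁, e₂
-- are the two old edges at v; as k ≥ 2, one of m + 1 and m + k is available.  A vertex of G other
-- than v sees only old edges, so it stays an AR-vertex.  A path vertex sees at most two distinct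
-- positive labels.  At v the labels a, b ≤ m < c with a ≠ b and c ≠ a + b have distinct subset sums.

module Submission where

open import Defs

open import Algebra.Properties.CommutativeSemigroup using (x∙yz≈y∙xz)
open import Data.Bool using (Bool; true; false; if_then_else_; _∨_)
open import Data.Empty using (⊥-elim)
open import Data.Fin using (Fin; zero; suc; toℕ; fromℕ; inject₁; opposite; _↑ˡ_; _↑ʳ_; splitAt; _≟_)
open import Data.Fin.Properties
  using (toℕ-injective; toℕ<n; toℕ-↑ˡ; toℕ-↑ʳ; toℕ-fromℕ; suc-injective; ↑ˡ-injective; ↑ʳ-injective;
         splitAt-↑ˡ; splitAt-↑ʳ; splitAt⁻¹-↑ˡ; splitAt⁻¹-↑ʳ; inject₁-injective; fromℕ≢inject₁;
         opposite-involutive)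
open import Data.Fin.Relation.Unary.Top using (view; ‵fromℕ; ‵inject₁)
open import Data.Fin.Subset using (Subset; inside; outside; ⊥; _∈_; _∉_; _⊆_; ∣_∣)
open import Data.Fin.Subset.Properties using (Empty-unique; ⊆-antisym)
open import Data.Nat using (ℕ; zero; suc; _+_; _≤_; _<_; z≤n; s≤s)
import Data.Nat.Properties as ℕ
open import Data.Nat.Properties
  using (+-assoc; +-identityʳ; +-cancelˡ-≡; +-cancelʳ-≡; +-comm; +-commutativeSemigroup; +-monoʳ-≤;
         m≤m+n; m<m+n; m<n+m; <⇒≢; <⇒≱; <-≤-trans; ≤-trans; ≤-reflexive)
  renaming (_≟_ to _≟ℕ_)
open import Data.Product using (Σ; ∃; _×_; _,_; proj₁; proj₂)
open import Data.Sum using (_⊎_; inj₁; inj₂; [_,_]′) renaming (map to map-⊎)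
open import Data.Vec using (Vec; []; _∷_; _++_; lookup; map; sum; _[_]≔_; here; there)
import Data.Vec as Vec
open import Data.Vec.Properties
  using ([]=⇒lookup; lookup⇒[]=; lookup∘tabulate; lookup∘update; lookup∘update′; tabulate-cong;
         ∷-injectiveˡ; ∷-injectiveʳ; map-∘; map-cong)
open import Data.Vec.Membership.Propositional using () renaming (_∈_ to _∈ᵥ_)
open import Data.Vec.Membership.Propositional.Properties using (∈-map⁺)
open import Data.Vec.Relation.Unary.All using (All; []; _∷_; universal)
import Data.Vec.Relation.Unary.All.Properties as All
open import Data.Vec.Relation.Unary.AllPairs using ([]; _∷_)
open import Data.Vec.Relation.Unary.Any using (here; there)
open import Data.Vec.Relation.Unary.Unique.Propositional using (Unique)
import Data.Vec.Relation.Unary.Unique.Propositional.Properties as Unique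
open import Function using (_∘_; id)
open import Function.Definitions using (Injective)
open import Relation.Nullary using (yes; no; contradiction)
open import Relation.Nullary.Decidable using (⌊_⌋)
open import Relation.Binary.PropositionalEquality

maskedSum : ∀ {r} → Vec Bool r → Vec ℕ r → ℕ
maskedSum []       []       = 0
maskedSum (b ∷ bs) (x ∷ xs) = (if b then x else 0) + maskedSum bs xs

-- Distinct subsets of xs, given as bit vectors, have distinct sums: the AR condition on a list of labels.
Dissociated : ∀ {r} → Vec ℕ r → Set
Dissociated xs = Injective _≡_ _≡_ (λ bs → maskedSum bs xs)

dissociated-[] : Dissociated []
dissociated-[] {[]} {[]} _ = refl

dissociated-∷ : ∀ {r x} {xs : Vec ℕ r} → Dissociated xs →
  (∀ bs cs → x + maskedSum bs xs ≢ maskedSum cs xs) → Dissociated (x ∷ xs)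
dissociated-∷ {x = x} d new {true  ∷ bs} {true  ∷ cs} eq = cong (true ∷_) (d (+-cancelˡ-≡ x _ _ eq))
dissociated-∷         d new {true  ∷ bs} {false ∷ cs} eq = ⊥-elim (new bs cs eq)
dissociated-∷         d new {false ∷ bs} {true  ∷ cs} eq = ⊥-elim (new cs bs (sym eq))
dissociated-∷         d new {false ∷ bs} {false ∷ cs} eq = cong (false ∷_) (d eq)

o<m⇒m+n≢o : ∀ {x t} s → t < x → x + s ≢ t
o<m⇒m+n≢o {x} s t<x eq = <⇒≱ t<x (subst (x ≤_) eq (m≤m+n x s))

m>0⇒m+n≢n : ∀ {x} t → 0 < x → x + t ≢ t
m>0⇒m+n≢n t 0<x eq = <⇒≢ (m<n+m t 0<x) (sym eq)

dissociated-singleton : ∀ {x} → 0 < x → Dissociated (x ∷ [])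
dissociated-singleton 0<x = dissociated-∷ dissociated-[] λ { [] [] → o<m⇒m+n≢o 0 0<x }

dissociated-pair : ∀ {x y} → 0 < x → 0 < y → x ≢ y → Dissociated (x ∷ y ∷ [])
dissociated-pair {x} {y} 0<x 0<y x≢y = dissociated-∷ (dissociated-singleton 0<y) new
  where
  new : ∀ bs cs → x + maskedSum bs (y ∷ []) ≢ maskedSum cs (y ∷ [])
  new (false ∷ []) (false ∷ []) = o<m⇒m+n≢o 0 0<x
  new (true  ∷ []) (false ∷ []) = o<m⇒m+n≢o (y + 0) 0<x
  new (false ∷ []) (true  ∷ []) eq = x≢y (+-cancelʳ-≡ 0 x y eq)
  new (true  ∷ []) (true  ∷ []) = m>0⇒m+n≢n (y + 0) 0<x

-- As z exceeds x and y, z + s = t is only possible for t = x + y and s = 0.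
dissociated-triple : ∀ {M x y z} → 0 < x → 0 < y → x ≢ y → x ≤ M → y ≤ M → M < z → z ≢ x + y →
  Dissociated (z ∷ x ∷ y ∷ [])
dissociated-triple {M} {x} {y} {z} 0<x 0<y x≢y x≤M y≤M M<z z≢x+y =
  dissociated-∷ (dissociated-pair 0<x 0<y x≢y) new
  where
  small : ∀ {t} s → t ≤ M → z + s ≢ t
  small s t≤M = o<m⇒m+n≢o s (<-≤-trans (s≤s t≤M) M<z)
  new : ∀ bs cs → z + maskedSum bs (x ∷ y ∷ []) ≢ maskedSum cs (x ∷ y ∷ [])
  new bs (false ∷ false ∷ []) = small _ z≤n
  new bs (true  ∷ false ∷ []) = small _ (subst (_≤ M) (sym (+-identityʳ x)) x≤M)
  new bs (false ∷ true  ∷ []) = small _ (subst (_≤ M) (sym (+-identityʳ y)) y≤M)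
  new (false ∷ false ∷ []) (true ∷ true ∷ []) eq =
    z≢x+y (trans (sym (+-identityʳ z)) (trans eq (cong (x +_) (+-identityʳ y))))
  new (true  ∷ false ∷ []) (true ∷ true ∷ []) eq =
    <⇒≱ (<-≤-trans (s≤s y≤M) M<z) (≤-reflexive (+-cancelʳ-≡ x z y (begin
      z + x       ≡⟨ cong (z +_) (sym (+-identityʳ x)) ⟩
      z + (x + 0) ≡⟨ eq ⟩
      x + (y + 0) ≡⟨ cong (x +_) (+-identityʳ y) ⟩
      x + y       ≡⟨ +-comm x y ⟩
      y + x       ∎)))
    where open ≡-Reasoning
  new (false ∷ true  ∷ []) (true ∷ true ∷ []) eq =
    <⇒≱ (<-≤-trans (s≤s x≤M) M<z) (≤-reflexive (+-cancelʳ-≡ (y + 0) z x eq))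
  new (true  ∷ true  ∷ []) (true ∷ true ∷ []) = m>0⇒m+n≢n _ (<-≤-trans (s≤s z≤n) M<z)

subsetSum-⊥ : ∀ {n} (f : Fin n → ℕ) → subsetSum f ⊥ ≡ 0
subsetSum-⊥ {zero}  f = refl
subsetSum-⊥ {suc n} f = subsetSum-⊥ (f ∘ suc)

subsetSum-cong : ∀ {n} {f g : Fin n → ℕ} → (∀ e → f e ≡ g e) → ∀ S → subsetSum f S ≡ subsetSum g S
subsetSum-cong f≗g S =
  cong sum (tabulate-cong λ e → cong (λ x → if lookup S e then x else 0) (f≗g e))

subsetSum-++ : ∀ {m k} (f : Fin (m + k) → ℕ) (S₁ : Subset m) (S₂ : Subset k) →
  subsetSum f (S₁ ++ S₂) ≡ subsetSum (λ x → f (x ↑ˡ k)) S₁ + subsetSum (λ i → f (m ↑ʳ i)) S₂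
subsetSum-++ f []       S₂ = refl
subsetSum-++ {k = k} f (s ∷ S₁) S₂ =
  trans (cong (b +_) (subsetSum-++ (f ∘ suc) S₁ S₂))
        (sym (+-assoc b (subsetSum (λ x → f (suc x ↑ˡ k)) S₁) (subsetSum (λ i → f (suc (_ ↑ʳ i))) S₂)))
  where b = if s then f zero else 0

subsetSum-remove : ∀ {n} (f : Fin n → ℕ) (S : Subset n) d →
  subsetSum f S ≡ (if lookup S d then f d else 0) + subsetSum f (S [ d ]≔ outside)
subsetSum-remove f (s ∷ S) zero    = refl
subsetSum-remove f (s ∷ S) (suc d) =
  trans (cong (b +_) (subsetSum-remove (f ∘ suc) S d))
        (x∙yz≈y∙xz +-commutativeSemigroup b (if lookup S d then f (suc d) else 0)
                                            (subsetSum (f ∘ suc) (S [ d ]≔ outside)))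
  where b = if s then f zero else 0

∈-update-outside⁻ : ∀ {n} {S : Subset n} {d e} → e ∈ S [ d ]≔ outside → e ≢ d × e ∈ S
∈-update-outside⁻ {S = S} {d} {e} e∈ =
  e≢d , lookup⇒[]= e S (trans (sym (lookup∘update′ e≢d S outside)) ([]=⇒lookup e∈))
  where
  e≢d : e ≢ d
  e≢d refl = contradiction (trans (sym ([]=⇒lookup e∈)) (lookup∘update e S outside)) λ ()

map-lookup-update : ∀ {n r} (S : Subset n) {d} {ds : Vec (Fin n) r} → All (d ≢_) ds →
  map (lookup (S [ d ]≔ outside)) ds ≡ map (lookup S) ds
map-lookup-update S []             = refl
map-lookup-update S (d≢e ∷ d∉ds) =
  cong₂ _∷_ (lookup∘update′ (d≢e ∘ sym) S outside) (map-lookup-update S d∉ds)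

subsetSum-cover : ∀ {n r} (f : Fin n → ℕ) {ds : Vec (Fin n) r} → Unique ds →
  ∀ S → (∀ {e} → e ∈ S → e ∈ᵥ ds) → subsetSum f S ≡ maskedSum (map (lookup S) ds) (map f ds)
subsetSum-cover f [] S S⊆ds =
  trans (cong (subsetSum f) (Empty-unique λ { (_ , e∈S) → contradiction (S⊆ds e∈S) λ () }))
        (subsetSum-⊥ f)
subsetSum-cover f {d ∷ ds} (d∉ds ∷ unique) S S⊆ds = begin
  subsetSum f S                                  ≡⟨ subsetSum-remove f S d ⟩
  b + subsetSum f S′                             ≡⟨ cong (b +_) (subsetSum-cover f unique S′ S′⊆ds) ⟩
  b + maskedSum (map (lookup S′) ds) (map f ds)  ≡⟨ cong (λ bs → b + maskedSum bs (map f ds))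
                                                         (map-lookup-update S d∉ds) ⟩
  b + maskedSum (map (lookup S) ds) (map f ds)   ∎
  where
  open ≡-Reasoning
  b  = if lookup S d then f d else 0
  S′ = S [ d ]≔ outside
  S′⊆ds : ∀ {e} → e ∈ S′ → e ∈ᵥ ds
  S′⊆ds e∈S′ with ∈-update-outside⁻ e∈S′
  ... | e≢d , e∈S with S⊆ds e∈S
  ...   | here e≡d   = contradiction e≡d e≢d
  ...   | there e∈ds = e∈ds

∈-map-≡ : ∀ {A B : Set} {r} {g h : A → B} {x} {xs : Vec A r} → x ∈ᵥ xs → map g xs ≡ map h xs → g x ≡ h x
∈-map-≡ (here refl) eq = ∷-injectiveˡ eq
∈-map-≡ (there x∈)  eq = ∈-map-≡ x∈ (∷-injectiveʳ eq)

⊆-from-cover : ∀ {n r} {S T : Subset n} {ds : Vec (Fin n) r} → (∀ {e} → e ∈ S → e ∈ᵥ ds) →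
  map (lookup S) ds ≡ map (lookup T) ds → S ⊆ T
⊆-from-cover {T = T} S⊆ds eq {e} e∈S =
  lookup⇒[]= e T (trans (sym (∈-map-≡ (S⊆ds e∈S) eq)) ([]=⇒lookup e∈S))

isARVertex-cover : ∀ (G : Graph) f w {r} (ds : Vec (Fin (m G)) r) → Unique ds →
  (∀ {e} → e ∈ incident G w → e ∈ᵥ ds) → Dissociated (map f ds) → IsARVertex G f w
isARVertex-cover G f w ds unique inc⊆ds dissociated S T S⊆ T⊆ eq =
  ⊆-antisym (⊆-from-cover S⊆ds bits) (⊆-from-cover T⊆ds (sym bits))
  where
  S⊆ds : ∀ {e} → e ∈ S → e ∈ᵥ ds
  S⊆ds = inc⊆ds ∘ S⊆
  T⊆ds : ∀ {e} → e ∈ T → e ∈ᵥ ds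
  T⊆ds = inc⊆ds ∘ T⊆
  bits : map (lookup S) ds ≡ map (lookup T) ds
  bits = dissociated (trans (sym (subsetSum-cover f unique S S⊆ds)) (trans eq (subsetSum-cover f unique T T⊆ds)))

enumerate : ∀ {n r} (p : Subset n) → ∣ p ∣ ≡ r →
  Σ (Vec (Fin n) r) λ ds → Unique ds × (∀ {e} → e ∈ p → e ∈ᵥ ds)
enumerate [] refl = [] , [] , λ ()
enumerate (outside ∷ p) eq with enumerate p eq
... | ds , unique , p⊆ds =
  map suc ds , Unique.map⁺ suc-injective unique , λ { (there e∈p) → ∈-map⁺ suc (p⊆ds e∈p) }
enumerate (inside ∷ p) refl with enumerate p refl
... | ds , unique , p⊆ds =
  zero ∷ map suc ds ,
  All.map⁺ (universal (λ _ ()) ds) ∷ Unique.map⁺ suc-injective unique ,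
  λ { here → here refl ; (there e∈p) → there (∈-map⁺ suc (p⊆ds e∈p)) }

Touches : ∀ {n} → Fin n × Fin n → Fin n → Set
Touches p w = proj₁ p ≡ w ⊎ proj₂ p ≡ w

incident-lookup : ∀ (H : Graph) w e →
  lookup (incident H w) e ≡ (⌊ proj₁ (ends H e) ≟ w ⌋ ∨ ⌊ proj₂ (ends H e) ≟ w ⌋)
incident-lookup H w e = lookup∘tabulate (λ e → ⌊ proj₁ (ends H e) ≟ w ⌋ ∨ ⌊ proj₂ (ends H e) ≟ w ⌋) e

∈-incident⁻ : ∀ (H : Graph) {w e} → e ∈ incident H w → Touches (ends H e) w
∈-incident⁻ H {w} {e} e∈
  with proj₁ (ends H e) ≟ w | proj₂ (ends H e) ≟ w | trans (sym (incident-lookup H w e)) ([]=⇒lookup e∈)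
... | yes p | _     | _  = inj₁ p
... | no _  | yes q | _  = inj₂ q
... | no _  | no _  | ()

∈-incident⁺ : ∀ (H : Graph) {w e} → Touches (ends H e) w → e ∈ incident H w
∈-incident⁺ H {w} {e} touches = lookup⇒[]= e _ (trans (incident-lookup H w e) (bit touches))
  where
  bit : Touches (ends H e) w → (⌊ proj₁ (ends H e) ≟ w ⌋ ∨ ⌊ proj₂ (ends H e) ≟ w ⌋) ≡ true
  bit t with proj₁ (ends H e) ≟ w | proj₂ (ends H e) ≟ w
  ... | yes _ | _     = refl
  ... | no _  | yes _ = refl
  ... | no ¬p | no ¬q = ⊥-elim ([ ¬p , ¬q ]′ t)

data SplitView (a b : ℕ) : Fin (a + b) → Set where
  ‵↑ˡ : ∀ x → SplitView a b (x ↑ˡ b)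
  ‵↑ʳ : ∀ i → SplitView a b (a ↑ʳ i)

splitView : ∀ a b e → SplitView a b e
splitView a b e with splitAt a e in eq
... | inj₁ x = subst (SplitView a b) (splitAt⁻¹-↑ˡ eq) (‵↑ˡ x)
... | inj₂ i = subst (SplitView a b) (splitAt⁻¹-↑ʳ eq) (‵↑ʳ i)

↑ˡ≢↑ʳ : ∀ {a b} (u : Fin a) (j : Fin b) → u ↑ˡ b ≢ a ↑ʳ j
↑ˡ≢↑ʳ {a} {b} u j eq = <⇒≢ (<-≤-trans (toℕ<n u) (m≤m+n a (toℕ j)))
  (trans (sym (toℕ-↑ˡ u b)) (trans (cong toℕ eq) (toℕ-↑ʳ a j)))

inject₁≢suc : ∀ {n} (j : Fin n) → inject₁ j ≢ suc j
inject₁≢suc zero    ()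
inject₁≢suc (suc j) eq = inject₁≢suc j (suc-injective eq)

∈-++⁺ˡ : ∀ {a b x} {S₁ : Subset a} (S₂ : Subset b) → x ∈ S₁ → x ↑ˡ b ∈ S₁ ++ S₂
∈-++⁺ˡ S₂ here       = here
∈-++⁺ˡ S₂ (there x∈) = there (∈-++⁺ˡ S₂ x∈)

∈-++⁺ʳ : ∀ {a b i} (S₁ : Subset a) {S₂ : Subset b} → i ∈ S₂ → a ↑ʳ i ∈ S₁ ++ S₂
∈-++⁺ʳ []       i∈ = i∈
∈-++⁺ʳ (s ∷ S₁) i∈ = there (∈-++⁺ʳ S₁ i∈)

module AttachPath (G : Graph) (v : Fin (n G)) (l : ℕ) where

  k : ℕ
  k = suc l

  G′ : Graph
  G′ = attachPath G v k

  ends-↑ˡ : ∀ x → ends G′ (x ↑ˡ k) ≡ (proj₁ (ends G x) ↑ˡ k , proj₂ (ends G x) ↑ˡ k)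
  ends-↑ˡ x rewrite splitAt-↑ˡ (m G) x k = refl

  ends-↑ʳ : ∀ i → ends G′ (m G ↑ʳ i) ≡ (pathVertex G v k (inject₁ i) , pathVertex G v k (suc i))
  ends-↑ʳ i rewrite splitAt-↑ʳ (m G) k i = refl

  pathVertex-injective : ∀ i j → pathVertex G v k i ≡ pathVertex G v k j → i ≡ j
  pathVertex-injective zero    zero    _  = refl
  pathVertex-injective zero    (suc j) eq = ⊥-elim (↑ˡ≢↑ʳ v j eq)
  pathVertex-injective (suc i) zero    eq = ⊥-elim (↑ˡ≢↑ʳ v i (sym eq))
  pathVertex-injective (suc i) (suc j) eq = cong suc (↑ʳ-injective (n G) i j eq)

  ↑ˡ≢pathVertex : ∀ {u} j → u ≢ v → u ↑ˡ k ≢ pathVertex G v k j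
  ↑ˡ≢pathVertex zero    u≢v eq = u≢v (↑ˡ-injective k _ _ eq)
  ↑ˡ≢pathVertex (suc j) _       = ↑ˡ≢↑ʳ _ j

  ↑ˡ∈incident-↑ˡ⁻ : ∀ {u x} → x ↑ˡ k ∈ incident G′ (u ↑ˡ k) → x ∈ incident G u
  ↑ˡ∈incident-↑ˡ⁻ {u} {x} x∈ = ∈-incident⁺ G (map-⊎ (↑ˡ-injective k _ u) (↑ˡ-injective k _ u)
    (subst (λ p → Touches p (u ↑ˡ k)) (ends-↑ˡ x) (∈-incident⁻ G′ x∈)))

  ↑ˡ∉incident-↑ʳ : ∀ {x j} → x ↑ˡ k ∉ incident G′ (n G ↑ʳ j)
  ↑ˡ∉incident-↑ʳ {x} {j} x∈ =
    [ ↑ˡ≢↑ʳ _ j , ↑ˡ≢↑ʳ _ j ]′ (subst (λ p → Touches p (n G ↑ʳ j)) (ends-↑ˡ x) (∈-incident⁻ G′ x∈))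

  ↑ʳ∈incident⁻ : ∀ {i w} → m G ↑ʳ i ∈ incident G′ w →
    w ≡ pathVertex G v k (inject₁ i) ⊎ w ≡ pathVertex G v k (suc i)
  ↑ʳ∈incident⁻ {i} {w} i∈ = map-⊎ sym sym (subst (λ p → Touches p w) (ends-↑ʳ i) (∈-incident⁻ G′ i∈))

  incident-v⊆ : ∀ {r} {ds : Vec (Fin (m G)) r} → (∀ {e} → e ∈ incident G v → e ∈ᵥ ds) →
    ∀ {e} → e ∈ incident G′ (v ↑ˡ k) → e ∈ᵥ ((m G ↑ʳ zero) ∷ map (_↑ˡ k) ds)
  incident-v⊆ inc⊆ds {e} e∈ with splitView (m G) k e
  ... | ‵↑ˡ x       = there (∈-map⁺ (_↑ˡ k) (inc⊆ds (↑ˡ∈incident-↑ˡ⁻ e∈)))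
  ... | ‵↑ʳ zero    = here refl
  ... | ‵↑ʳ (suc i) =
    [ (λ ()) ∘ pathVertex-injective zero (suc (inject₁ i))
    , (λ ()) ∘ pathVertex-injective zero (suc (suc i)) ]′ (↑ʳ∈incident⁻ e∈)

  incident-last⊆ : ∀ {e} → e ∈ incident G′ (n G ↑ʳ fromℕ l) → e ∈ᵥ ((m G ↑ʳ fromℕ l) ∷ [])
  incident-last⊆ {e} e∈ with splitView (m G) k e
  ... | ‵↑ˡ x = ⊥-elim (↑ˡ∉incident-↑ʳ e∈)
  ... | ‵↑ʳ i with ↑ʳ∈incident⁻ e∈
  ...   | inj₁ eq = ⊥-elim (fromℕ≢inject₁ (pathVertex-injective (suc (fromℕ l)) (inject₁ i) eq))
  ...   | inj₂ eq = here (cong (m G ↑ʳ_) (sym (↑ʳ-injective (n G) _ _ eq)))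

  incident-inner⊆ : ∀ {j e} → e ∈ incident G′ (n G ↑ʳ inject₁ j) →
    e ∈ᵥ ((m G ↑ʳ inject₁ j) ∷ (m G ↑ʳ suc j) ∷ [])
  incident-inner⊆ {j} {e} e∈ with splitView (m G) k e
  ... | ‵↑ˡ x = ⊥-elim (↑ˡ∉incident-↑ʳ e∈)
  ... | ‵↑ʳ i with ↑ʳ∈incident⁻ e∈
  ...   | inj₁ eq = there (here (cong (m G ↑ʳ_)
                      (sym (inject₁-injective (pathVertex-injective (suc (inject₁ j)) (inject₁ i) eq)))))
  ...   | inj₂ eq = here (cong (m G ↑ʳ_) (sym (↑ʳ-injective (n G) _ _ eq)))

  module _ {f : Fin (m G) → ℕ} {F : Fin (m G + k) → ℕ} (F-↑ˡ : ∀ x → F (x ↑ˡ k) ≡ f x) where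

    isARVertex-↑ˡ : ∀ {u} → u ≢ v → IsARVertex G f u → IsARVertex G′ F (u ↑ˡ k)
    isARVertex-↑ˡ {u} u≢v u-isAR S T S⊆ T⊆ eq with Vec.splitAt (m G) S | Vec.splitAt (m G) T
    ... | S₁ , S₂ , refl | T₁ , T₂ , refl =
      cong₂ _++_ (u-isAR S₁ T₁ (old-⊆ S₁ S₂ S⊆) (old-⊆ T₁ T₂ T⊆)
                   (trans (sym (old-sum S₁ S₂ S⊆)) (trans eq (old-sum T₁ T₂ T⊆))))
                 (trans (new-empty S₁ S₂ S⊆) (sym (new-empty T₁ T₂ T⊆)))
      where
      old-⊆ : ∀ S₁ S₂ → S₁ ++ S₂ ⊆ incident G′ (u ↑ˡ k) → S₁ ⊆ incident G u
      old-⊆ S₁ S₂ S⊆ x∈ = ↑ˡ∈incident-↑ˡ⁻ (S⊆ (∈-++⁺ˡ S₂ x∈))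
      new-empty : ∀ S₁ S₂ → S₁ ++ S₂ ⊆ incident G′ (u ↑ˡ k) → S₂ ≡ ⊥
      new-empty S₁ S₂ S⊆ = Empty-unique λ { (j , j∈) →
        [ ↑ˡ≢pathVertex (inject₁ j) u≢v , ↑ˡ≢pathVertex (suc j) u≢v ]′
          (↑ʳ∈incident⁻ (S⊆ (∈-++⁺ʳ S₁ j∈))) }
      old-sum : ∀ S₁ S₂ → S₁ ++ S₂ ⊆ incident G′ (u ↑ˡ k) → subsetSum F (S₁ ++ S₂) ≡ subsetSum f S₁
      old-sum S₁ S₂ S⊆ = begin
        subsetSum F (S₁ ++ S₂)                           ≡⟨ subsetSum-++ F S₁ S₂ ⟩
        subsetSum (F ∘ (_↑ˡ k)) S₁ + subsetSum new S₂   ≡⟨ cong₂ _+_ (subsetSum-cong F-↑ˡ S₁)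
                                                                      (cong (subsetSum new) (new-empty S₁ S₂ S⊆)) ⟩
        subsetSum f S₁ + subsetSum new ⊥                 ≡⟨ cong (subsetSum f S₁ +_) (subsetSum-⊥ new) ⟩
        subsetSum f S₁ + 0                               ≡⟨ +-identityʳ _ ⟩
        subsetSum f S₁                                   ∎
        where
        open ≡-Reasoning
        new : Fin k → ℕ
        new i = F (m G ↑ʳ i)

    isARVertex-v : ∀ {r} (ds : Vec (Fin (m G)) r) → Unique ds → (∀ {e} → e ∈ incident G v → e ∈ᵥ ds) →
      Dissociated (F (m G ↑ʳ zero) ∷ map f ds) → IsARVertex G′ F (v ↑ˡ k)
    isARVertex-v ds unique inc⊆ds dissociated =
      isARVertex-cover G′ F (v ↑ˡ k) ((m G ↑ʳ zero) ∷ map (_↑ˡ k) ds)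
        (All.map⁺ (universal (λ x → ↑ˡ≢↑ʳ x zero ∘ sym) ds) ∷ Unique.map⁺ (↑ˡ-injective k _ _) unique)
        (incident-v⊆ inc⊆ds)
        (subst Dissociated (cong (F (m G ↑ʳ zero) ∷_) labels) dissociated)
      where
      labels : map f ds ≡ map F (map (_↑ˡ k) ds)
      labels = trans (sym (map-cong F-↑ˡ ds)) (map-∘ F (_↑ˡ k) ds)

  module _ {F : Fin (m G + k) → ℕ} (F-injective : Injective _≡_ _≡_ F) (F-positive : ∀ e → 0 < F e) where

    isARVertex-↑ʳ : ∀ j → IsARVertex G′ F (n G ↑ʳ j)
    isARVertex-↑ʳ j with view j
    ... | ‵fromℕ =
      isARVertex-cover G′ F _ ((m G ↑ʳ fromℕ l) ∷ []) ([] ∷ []) incident-last⊆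
        (dissociated-singleton (F-positive _))
    ... | ‵inject₁ j =
      isARVertex-cover G′ F _ ((m G ↑ʳ inject₁ j) ∷ (m G ↑ʳ suc j) ∷ []) ((distinct ∷ []) ∷ [] ∷ [])
        incident-inner⊆
        (dissociated-pair (F-positive _) (F-positive _) (distinct ∘ F-injective))
      where
      distinct : m G ↑ʳ inject₁ j ≢ m G ↑ʳ suc j
      distinct = inject₁≢suc j ∘ ↑ʳ-injective (m G) _ _

extendLabels : ∀ {a b} → (Fin a → ℕ) → (Fin b → ℕ) → Fin (a + b) → ℕ
extendLabels {a} f g e = [ f , g ]′ (splitAt a e)

extendLabels-↑ˡ : ∀ {a b} (f : Fin a → ℕ) (g : Fin b → ℕ) x → extendLabels f g (x ↑ˡ b) ≡ f x
extendLabels-↑ˡ {a} {b} f g x rewrite splitAt-↑ˡ a x b = refl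

extendLabels-↑ʳ : ∀ {a b} (f : Fin a → ℕ) (g : Fin b → ℕ) i → extendLabels f g (a ↑ʳ i) ≡ g i
extendLabels-↑ʳ {a} {b} f g i rewrite splitAt-↑ʳ a b i = refl

extendLabels-injective : ∀ {a b} {f : Fin a → ℕ} {g : Fin b → ℕ} →
  Injective _≡_ _≡_ f → Injective _≡_ _≡_ g → (∀ x i → f x ≢ g i) → Injective _≡_ _≡_ (extendLabels f g)
extendLabels-injective {a} {b} {f} {g} f-injective g-injective f≢g {e} {e′} eq
  with splitView a b e | splitView a b e′
... | ‵↑ˡ x | ‵↑ˡ y = cong (_↑ˡ b) (f-injective (subst₂ _≡_ (extendLabels-↑ˡ f g x) (extendLabels-↑ˡ f g y) eq))
... | ‵↑ˡ x | ‵↑ʳ j = ⊥-elim (f≢g x j (subst₂ _≡_ (extendLabels-↑ˡ f g x) (extendLabels-↑ʳ f g j) eq))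
... | ‵↑ʳ i | ‵↑ˡ y = ⊥-elim (f≢g y i (subst₂ _≡_ (extendLabels-↑ˡ f g y) (extendLabels-↑ʳ f g i) (sym eq)))
... | ‵↑ʳ i | ‵↑ʳ j = cong (a ↑ʳ_) (g-injective (subst₂ _≡_ (extendLabels-↑ʳ f g i) (extendLabels-↑ʳ f g j) eq))

pathLabels : ℕ → ∀ {b} → (Fin b → Fin b) → Fin b → ℕ
pathLabels M σ i = M + suc (toℕ (σ i))

pathLabels-injective : ∀ M {b} {σ : Fin b → Fin b} → Injective _≡_ _≡_ σ → Injective _≡_ _≡_ (pathLabels M σ)
pathLabels-injective M σ-injective eq = σ-injective (toℕ-injective (ℕ.suc-injective (+-cancelˡ-≡ M _ _ eq)))

M<pathLabels : ∀ M {b} (σ : Fin b → Fin b) i → M < pathLabels M σ i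
M<pathLabels M σ i = m<m+n M (s≤s z≤n)

pathLabels≤M+b : ∀ M {b} (σ : Fin b → Fin b) i → pathLabels M σ i ≤ M + b
pathLabels≤M+b M σ i = +-monoʳ-≤ M (toℕ<n (σ i))

attachPath-isARGraph : ∀ (G : Graph) (v : Fin (n G)) l (f : Fin (m G) → ℕ) →
  (∀ e → (1 ≤ f e) × (f e ≤ m G)) → IsARLabeling G f →
  ∀ {e₁ e₂} → Unique (e₁ ∷ e₂ ∷ []) → (∀ {e} → e ∈ incident G v → e ∈ᵥ (e₁ ∷ e₂ ∷ [])) →
  (σ : Fin (suc l) → Fin (suc l)) → Injective _≡_ _≡_ σ → pathLabels (m G) σ zero ≢ f e₁ + f e₂ →
  IsARGraph (attachPath G v (suc l))
attachPath-isARGraph G v l f f-bounded (f-injective , f-isAR) {e₁} {e₂} unique@((e₁≢e₂ ∷ []) ∷ _) inc⊆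
                     σ σ-injective avoids = F , F-bounded , F-injective , isAR
  where
  open AttachPath G v l
  M = m G
  g = pathLabels M σ
  F = extendLabels f g

  F-injective : Injective _≡_ _≡_ F
  F-injective = extendLabels-injective f-injective (pathLabels-injective M σ-injective)
    (λ x i → <⇒≢ (<-≤-trans (s≤s (proj₂ (f-bounded x))) (M<pathLabels M σ i)))

  F-bounded : ∀ e → (1 ≤ F e) × (F e ≤ M + k)
  F-bounded e with splitView M k e
  ... | ‵↑ˡ x rewrite extendLabels-↑ˡ f g x = proj₁ (f-bounded x) , ≤-trans (proj₂ (f-bounded x)) (m≤m+n M k)
  ... | ‵↑ʳ i rewrite extendLabels-↑ʳ f g i = <-≤-trans (s≤s z≤n) (M<pathLabels M σ i) , pathLabels≤M+b M σ i

  dissociated-v : Dissociated (F (M ↑ʳ zero) ∷ f e₁ ∷ f e₂ ∷ [])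
  dissociated-v rewrite extendLabels-↑ʳ f g zero =
    dissociated-triple (proj₁ (f-bounded e₁)) (proj₁ (f-bounded e₂)) (e₁≢e₂ ∘ f-injective)
      (proj₂ (f-bounded e₁)) (proj₂ (f-bounded e₂)) (M<pathLabels M σ zero) avoids

  isAR : ∀ w → IsARVertex G′ F w
  isAR w with splitView (n G) k w
  ... | ‵↑ʳ j = isARVertex-↑ʳ F-injective (proj₁ ∘ F-bounded) j
  ... | ‵↑ˡ u with u ≟ v
  ...   | yes refl = isARVertex-v (extendLabels-↑ˡ f g) (e₁ ∷ e₂ ∷ []) unique inc⊆ dissociated-v
  ...   | no u≢v   = isARVertex-↑ˡ (extendLabels-↑ˡ f g) u≢v (f-isAR u)

-- With at least two path edges, the first one can be labelled M + 1 or M + k, and one of these avoids s.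
firstLabel-avoiding : ∀ M l s →
  ∃ λ (σ : Fin (suc (suc l)) → Fin (suc (suc l))) → Injective _≡_ _≡_ σ × pathLabels M σ zero ≢ s
firstLabel-avoiding M l s with M + 1 ≟ℕ s
... | no  M+1≢s = id , id , M+1≢s
... | yes refl  = opposite , opposite-injective , λ eq →
  contradiction (trans (sym (toℕ-fromℕ (suc l))) (ℕ.suc-injective (+-cancelˡ-≡ M _ _ eq))) λ ()
  where
  opposite-injective : Injective _≡_ _≡_ opposite
  opposite-injective {i} {j} eq =
    trans (sym (opposite-involutive i)) (trans (cong opposite eq) (opposite-involutive j))

mainTheorem18 : (G : Graph) → IsSimple G → IsARGraph G →
    (v : Fin (n G)) → degree G v ≡ 2 →
    (k : ℕ) → 2 ≤ k → IsARGraph (attachPath G v k)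
mainTheorem18 G _ (f , f-bounded , f-isARLabeling) v degree≡2 (suc (suc l)) (s≤s (s≤s z≤n))
  with enumerate (incident G v) degree≡2
... | e₁ ∷ e₂ ∷ [] , unique , inc⊆ with firstLabel-avoiding (m G) l (f e₁ + f e₂)
...   | σ , σ-injective , avoids =
  attachPath-isARGraph G v (suc l) f f-bounded f-isARLabeling unique inc⊆ σ σ-injective avoids
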